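{- Let $B=\bigwedge_{i=1}^n(E_i\to F_i)$ and $C=\bigvee_{i=n+1}^{n+m}E_i$ for formulas $E_1,\dots,E_{n+m},F_1,\dots,F_n$. Then $(B\to C)\rhd_{{\sf NNIL}({\sf par})}\bigvee_{i=1}^{n+m}B[E_i]$, where $B[E]:=E$ if $E\in{\sf par}\cup\{\bot\}$ and $B[E]:=B\to E$ otherwise.
   Context: Language: $\wedge,\vee,\to,\bot$ over finite atoms ${\sf atom}={\sf var}\cup{\sf par}$ (disjoint variables and parameters); $\vdash$ is ${\sf IPC}$-derivability. ${\sf NNIL}$ is the least class containing atoms, $\bot,\top$, closed under $\wedge,\vee$, and containing $B\to C$ whenever $C\in{\sf NNIL}$ and $B$ is built from atoms, $\bot,\top$ by $\wedge,\vee$ only; ${\sf NNIL}({\sf par})$: those ${\sf NNIL}$ formulas whose atoms are all parameters. Preservativity: $A\rhd_\Gamma D$ iff for every $E\in\Gamma$, $\vdash E\to A$ implies $\vdash E\to D$. -}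

module Defs where

open import Data.Nat using (ℕ; zero; suc; _+_)
open import Data.Fin using (Fin; zero; suc)
open import Data.List using (List; []; _∷_)
open import Data.List.Membership.Propositional using (_∈_)
open import Data.Empty using (⊥)
open import Data.Unit using (⊤)

data Atom (nv np : ℕ) : Set where
  var : Fin nv → Atom nv np
  par : Fin np → Atom nv np

data Form (nv np : ℕ) : Set where
  at   : Atom nv np → Form nv np
  ⊥'   : Form nv np
  _∧'_ : Form nv np → Form nv np → Form nv np
  _∨'_ : Form nv np → Form nv np → Form nv np
  _⇒_  : Form nv np → Form nv np → Form nv np

infixr 6 _∧'_
infixr 5 _∨'_
infixr 4 _⇒_

module _ {nv np : ℕ} where

  ⊤' : Form nv np
  ⊤' = ⊥' ⇒ ⊥'

  infix 2 _⊢_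
  data _⊢_ (Γ : List (Form nv np)) : Form nv np → Set where
    hyp  : ∀ {A} → A ∈ Γ → Γ ⊢ A
    ⊥E   : ∀ {A} → Γ ⊢ ⊥' → Γ ⊢ A
    ∧I   : ∀ {A B} → Γ ⊢ A → Γ ⊢ B → Γ ⊢ A ∧' B
    ∧E₁  : ∀ {A B} → Γ ⊢ A ∧' B → Γ ⊢ A
    ∧E₂  : ∀ {A B} → Γ ⊢ A ∧' B → Γ ⊢ B
    ∨I₁  : ∀ {A B} → Γ ⊢ A → Γ ⊢ A ∨' B
    ∨I₂  : ∀ {A B} → Γ ⊢ B → Γ ⊢ A ∨' B
    ∨E   : ∀ {A B C} → Γ ⊢ A ∨' B → (A ∷ Γ) ⊢ C → (B ∷ Γ) ⊢ C → Γ ⊢ C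
    ⇒I   : ∀ {A B} → (A ∷ Γ) ⊢ B → Γ ⊢ A ⇒ B
    ⇒E   : ∀ {A B} → Γ ⊢ A ⇒ B → Γ ⊢ A → Γ ⊢ B

  ⊢_ : Form nv np → Set
  ⊢ A = [] ⊢ A

  data Simple : Form nv np → Set where
    s-at  : ∀ a → Simple (at a)
    s-⊥   : Simple ⊥'
    s-⊤   : Simple ⊤'
    s-∧   : ∀ {A B} → Simple A → Simple B → Simple (A ∧' B)
    s-∨   : ∀ {A B} → Simple A → Simple B → Simple (A ∨' B)

  data NNIL : Form nv np → Set where
    n-at  : ∀ a → NNIL (at a)
    n-⊥   : NNIL ⊥'
    n-⊤   : NNIL ⊤'
    n-∧   : ∀ {A B} → NNIL A → NNIL B → NNIL (A ∧' B)
    n-∨   : ∀ {A B} → NNIL A → NNIL B → NNIL (A ∨' B)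
    n-⇒   : ∀ {A B} → Simple A → NNIL B → NNIL (A ⇒ B)

  ParOnly : Form nv np → Set
  ParOnly (at (var _)) = ⊥
  ParOnly (at (par _)) = ⊤
  ParOnly ⊥'           = ⊤
  ParOnly (A ∧' B)     = ParOnly A Data.Product.× ParOnly B
    where import Data.Product
  ParOnly (A ∨' B)     = ParOnly A Data.Product.× ParOnly B
    where import Data.Product
  ParOnly (A ⇒ B)      = ParOnly A Data.Product.× ParOnly B
    where import Data.Product

  NNILpar : Form nv np → Set
  NNILpar E = NNIL E Data.Product.× ParOnly E
    where import Data.Product

  _▷[_]_ : Form nv np → (Form nv np → Set) → Form nv np → Set
  A ▷[ Γ ] D = ∀ E → Γ E → ⊢ (E ⇒ A) → ⊢ (E ⇒ D)

  ⋀ : (k : ℕ) → (Fin k → Form nv np) → Form nv np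
  ⋀ zero f = ⊤'
  ⋀ (suc zero) f = f zero
  ⋀ (suc (suc k)) f = f zero ∧' ⋀ (suc k) (λ i → f (suc i))

  ⋁ : (k : ℕ) → (Fin k → Form nv np) → Form nv np
  ⋁ zero f = ⊥'
  ⋁ (suc zero) f = f zero
  ⋁ (suc (suc k)) f = f zero ∨' ⋁ (suc k) (λ i → f (suc i))

  _[_] : Form nv np → Form nv np → Form nv np
  B [ at (par p) ] = at (par p)
  B [ ⊥' ]         = ⊥'
  B [ E ]          = B ⇒ E

-- The proof goes through a translation ⟦_⟧ relative to B and D which keeps atoms,
-- ⊥, ∧ and ∨ and sends X → Y to (⟦X⟧ → ⟦Y⟧ ∨ D) ∧ (B → X → Y). A derivation of A
-- from Γ becomes a derivation of ⟦A⟧ ∨ D from ⟦Γ⟧; an NNIL formula implies its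
-- translation, and under B every translation ⟦Z⟧ implies Z.
-- Here ⟦B⟧ is provable, since each ⟦Eᵢ⟧ already yields B[Eᵢ] and hence D, and ⟦C⟧
-- yields D for the same reason. So from ⊢ E → (B → C) with E ∈ NNIL we get
-- E ⊢ ⟦C⟧ ∨ D, and therefore E ⊢ D.
module Submission where

open import Defs
open import Data.Nat using (ℕ; zero; suc; _+_)
open import Data.Fin using (Fin; zero; suc; _↑ˡ_; _↑ʳ_)
open import Data.List using (List; []; _∷_)
open import Data.List.Membership.Propositional using (_∈_)
open import Data.List.Relation.Unary.Any using (here; there)
open import Data.List.Relation.Binary.Subset.Propositional using (_⊆_)
open import Data.List.Relation.Binary.Subset.Propositional.Properties using (∷⁺ʳ)
open import Data.Product using (_,_)
open import Function using (id)
open import Relation.Binary.PropositionalEquality using (refl)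

module _ {nv np : ℕ} where

  private
    Fm : Set
    Fm = Form nv np
    Ctx : Set
    Ctx = List Fm
    variable
      Γ Δ : Ctx
      A X Y D : Fm

  hyp₀ : A ∷ Γ ⊢ A
  hyp₀ = hyp (here refl)

  hyp₁ : X ∷ A ∷ Γ ⊢ A
  hyp₁ = hyp (there (here refl))

  ⊢-mono : Γ ⊆ Δ → Γ ⊢ A → Δ ⊢ A
  ⊢-mono ρ (hyp p)    = hyp (ρ p)
  ⊢-mono ρ (⊥E d)     = ⊥E (⊢-mono ρ d)
  ⊢-mono ρ (∧I d e)   = ∧I (⊢-mono ρ d) (⊢-mono ρ e)
  ⊢-mono ρ (∧E₁ d)    = ∧E₁ (⊢-mono ρ d)
  ⊢-mono ρ (∧E₂ d)    = ∧E₂ (⊢-mono ρ d)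
  ⊢-mono ρ (∨I₁ d)    = ∨I₁ (⊢-mono ρ d)
  ⊢-mono ρ (∨I₂ d)    = ∨I₂ (⊢-mono ρ d)
  ⊢-mono ρ (∨E d e f) = ∨E (⊢-mono ρ d) (⊢-mono (∷⁺ʳ _ ρ) e) (⊢-mono (∷⁺ʳ _ ρ) f)
  ⊢-mono ρ (⇒I d)     = ⇒I (⊢-mono (∷⁺ʳ _ ρ) d)
  ⊢-mono ρ (⇒E d e)   = ⇒E (⊢-mono ρ d) (⊢-mono ρ e)

  ⊢-weaken : Γ ⊢ A → X ∷ Γ ⊢ A
  ⊢-weaken = ⊢-mono there

  Subst : (Fm → Fm) → Ctx → Ctx → Set
  Subst φ Δ Γ = ∀ {A} → A ∈ Γ → Δ ⊢ φ A

  Subst-weaken : ∀ {φ} → Subst φ Δ Γ → Subst φ (X ∷ Δ) Γ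
  Subst-weaken σ p = ⊢-weaken (σ p)

  Subst-lift : ∀ {φ} → Subst φ Δ Γ → Subst φ (φ X ∷ Δ) (X ∷ Γ)
  Subst-lift σ (here refl) = hyp₀
  Subst-lift σ (there p)   = Subst-weaken σ p

  ⊢-subst : Subst id Δ Γ → Γ ⊢ A → Δ ⊢ A
  ⊢-subst σ (hyp p)    = σ p
  ⊢-subst σ (⊥E d)     = ⊥E (⊢-subst σ d)
  ⊢-subst σ (∧I d e)   = ∧I (⊢-subst σ d) (⊢-subst σ e)
  ⊢-subst σ (∧E₁ d)    = ∧E₁ (⊢-subst σ d)
  ⊢-subst σ (∧E₂ d)    = ∧E₂ (⊢-subst σ d)
  ⊢-subst σ (∨I₁ d)    = ∨I₁ (⊢-subst σ d)
  ⊢-subst σ (∨I₂ d)    = ∨I₂ (⊢-subst σ d)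
  ⊢-subst σ (∨E d e f) = ∨E (⊢-subst σ d) (⊢-subst (Subst-lift σ) e) (⊢-subst (Subst-lift σ) f)
  ⊢-subst σ (⇒I d)     = ⇒I (⊢-subst (Subst-lift σ) d)
  ⊢-subst σ (⇒E d e)   = ⇒E (⊢-subst σ d) (⊢-subst σ e)

  ⋀-elim : ∀ k (f : Fin k → Fm) → Δ ⊢ ⋀ k f → (i : Fin k) → Δ ⊢ f i
  ⋀-elim (suc zero)    f p zero    = p
  ⋀-elim (suc (suc k)) f p zero    = ∧E₁ p
  ⋀-elim (suc (suc k)) f p (suc i) = ⋀-elim (suc k) (λ i → f (suc i)) (∧E₂ p) i

  ⋁-intro : ∀ k (f : Fin k → Fm) (i : Fin k) → Δ ⊢ f i → Δ ⊢ ⋁ k f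
  ⋁-intro (suc zero)    f zero    p = p
  ⋁-intro (suc (suc k)) f zero    p = ∨I₁ p
  ⋁-intro (suc (suc k)) f (suc i) p = ∨I₂ (⋁-intro (suc k) (λ i → f (suc i)) i p)

  -- Derivations of X ∨' D behave like computations of X that may abort with D.
  ∨-bind : Δ ⊢ X ∨' D → X ∷ Δ ⊢ Y ∨' D → Δ ⊢ Y ∨' D
  ∨-bind p k = ∨E p k (∨I₂ hyp₀)

  ∨-map : Δ ⊢ X ∨' D → X ∷ Δ ⊢ Y → Δ ⊢ Y ∨' D
  ∨-map p k = ∨-bind p (∨I₁ k)

  ∨-collapse : Δ ⊢ X ∨' D → X ∷ Δ ⊢ D → Δ ⊢ D
  ∨-collapse p k = ∨E p k hyp₀

  module Translation (B D : Fm) where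

    ⟦_⟧ : Fm → Fm
    ⟦ at a ⟧   = at a
    ⟦ ⊥' ⟧     = ⊥'
    ⟦ X ∧' Y ⟧ = ⟦ X ⟧ ∧' ⟦ Y ⟧
    ⟦ X ∨' Y ⟧ = ⟦ X ⟧ ∨' ⟦ Y ⟧
    ⟦ X ⇒ Y ⟧  = (⟦ X ⟧ ⇒ ⟦ Y ⟧ ∨' D) ∧' (B ⇒ X ⇒ Y)

    from⟦⟧ : ∀ Z → Δ ⊢ B → Δ ⊢ ⟦ Z ⟧ → Δ ⊢ Z
    from⟦⟧ (at a)   b p = p
    from⟦⟧ ⊥'       b p = p
    from⟦⟧ (X ∧' Y) b p = ∧I (from⟦⟧ X b (∧E₁ p)) (from⟦⟧ Y b (∧E₂ p))
    from⟦⟧ (X ∨' Y) b p = ∨E p (∨I₁ (from⟦⟧ X (⊢-weaken b) hyp₀)) (∨I₂ (from⟦⟧ Y (⊢-weaken b) hyp₀))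
    from⟦⟧ (X ⇒ Y)  b p = ⇒E (∧E₂ p) b

    simple-from⟦⟧ : ∀ {S} → Simple S → Δ ⊢ ⟦ S ⟧ → Δ ⊢ S
    simple-from⟦⟧ (s-at a)  p = p
    simple-from⟦⟧ s-⊥       p = p
    simple-from⟦⟧ s-⊤       p = ⇒I hyp₀
    simple-from⟦⟧ (s-∧ s t) p = ∧I (simple-from⟦⟧ s (∧E₁ p)) (simple-from⟦⟧ t (∧E₂ p))
    simple-from⟦⟧ (s-∨ s t) p = ∨E p (∨I₁ (simple-from⟦⟧ s hyp₀)) (∨I₂ (simple-from⟦⟧ t hyp₀))

    ⟦⊤⟧ : Δ ⊢ ⟦ ⊤' ⟧
    ⟦⊤⟧ = ∧I (⇒I (∨I₁ hyp₀)) (⇒I (⇒I hyp₀))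

    nnil-to⟦⟧ : NNIL A → Δ ⊢ A → Δ ⊢ ⟦ A ⟧
    nnil-to⟦⟧ (n-at a)  p = p
    nnil-to⟦⟧ n-⊥       p = p
    nnil-to⟦⟧ n-⊤       p = ⟦⊤⟧
    nnil-to⟦⟧ (n-∧ a b) p = ∧I (nnil-to⟦⟧ a (∧E₁ p)) (nnil-to⟦⟧ b (∧E₂ p))
    nnil-to⟦⟧ (n-∨ a b) p = ∨E p (∨I₁ (nnil-to⟦⟧ a hyp₀)) (∨I₂ (nnil-to⟦⟧ b hyp₀))
    nnil-to⟦⟧ (n-⇒ s b) p =
      ∧I (⇒I (∨I₁ (nnil-to⟦⟧ b (⇒E (⊢-weaken p) (simple-from⟦⟧ s hyp₀))))) (⇒I (⊢-weaken p))

    ⟦⟧-mp : Δ ⊢ ⟦ X ⇒ Y ⟧ ∨' D → Δ ⊢ ⟦ X ⟧ ∨' D → Δ ⊢ ⟦ Y ⟧ ∨' D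
    ⟦⟧-mp p q = ∨-bind p (∨-bind (⊢-weaken q) (⇒E (∧E₁ hyp₁) hyp₀))

    translate : Subst ⟦_⟧ Δ Γ → Γ ⊢ A → Δ ⊢ ⟦ A ⟧ ∨' D
    translate σ (hyp p)    = ∨I₁ (σ p)
    translate σ (⊥E d)     = ∨-bind (translate σ d) (⊥E hyp₀)
    translate σ (∧I d e)   = ∨-bind (translate σ d) (∨-map (⊢-weaken (translate σ e)) (∧I hyp₁ hyp₀))
    translate σ (∧E₁ d)    = ∨-map (translate σ d) (∧E₁ hyp₀)
    translate σ (∧E₂ d)    = ∨-map (translate σ d) (∧E₂ hyp₀)
    translate σ (∨I₁ d)    = ∨-map (translate σ d) (∨I₁ hyp₀)
    translate σ (∨I₂ d)    = ∨-map (translate σ d) (∨I₂ hyp₀)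
    translate σ (∨E d e f) =
      ∨-bind (translate σ d) (∨E hyp₀ (translate (Subst-lift (Subst-weaken σ)) e)
                                      (translate (Subst-lift (Subst-weaken σ)) f))
    -- Under B, the translated hypotheses give back Γ itself, so ⇒I d can be reused.
    translate σ (⇒I d)     =
      ∨I₁ (∧I (⇒I (translate (Subst-lift σ) d))
              (⇒I (⊢-subst (λ {Z} p → from⟦⟧ Z hyp₀ (⊢-weaken (σ p))) (⇒I d))))
    translate σ (⇒E d e)   = ⟦⟧-mp (translate σ d) (translate σ e)

    ⟦⟧-⋀-intro : ∀ k (f : Fin k → Fm) → (∀ i → Δ ⊢ ⟦ f i ⟧) → Δ ⊢ ⟦ ⋀ k f ⟧
    ⟦⟧-⋀-intro zero          f h = ⟦⊤⟧
    ⟦⟧-⋀-intro (suc zero)    f h = h zero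
    ⟦⟧-⋀-intro (suc (suc k)) f h =
      ∧I (h zero) (⟦⟧-⋀-intro (suc k) (λ i → f (suc i)) (λ i → h (suc i)))

    ⟦⟧-⋁-elim : ∀ k (f : Fin k → Fm) → (∀ {Γ} i → Γ ⊢ ⟦ f i ⟧ → Γ ⊢ X) → Δ ⊢ ⟦ ⋁ k f ⟧ → Δ ⊢ X
    ⟦⟧-⋁-elim zero          f h p = ⊥E p
    ⟦⟧-⋁-elim (suc zero)    f h p = h zero p
    ⟦⟧-⋁-elim (suc (suc k)) f h p =
      ∨E p (h zero hyp₀) (⟦⟧-⋁-elim (suc k) (λ i → f (suc i)) (λ i → h (suc i)) hyp₀)

    ⟦⟧-to-bracket : ∀ Z → Δ ⊢ ⟦ Z ⟧ → Δ ⊢ B [ Z ]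
    ⟦⟧-to-bracket (at (var v)) p = ⇒I (⊢-weaken p)
    ⟦⟧-to-bracket (at (par q)) p = p
    ⟦⟧-to-bracket ⊥'           p = p
    ⟦⟧-to-bracket (X ∧' Y)     p = ⇒I (from⟦⟧ (X ∧' Y) hyp₀ (⊢-weaken p))
    ⟦⟧-to-bracket (X ∨' Y)     p = ⇒I (from⟦⟧ (X ∨' Y) hyp₀ (⊢-weaken p))
    ⟦⟧-to-bracket (X ⇒ Y)      p = ⇒I (from⟦⟧ (X ⇒ Y) hyp₀ (⊢-weaken p))

  ▷-NNIL-by-translation : (B C D : Fm) → let open Translation B D in
                          ⊢ ⟦ B ⟧ → ⟦ C ⟧ ∷ [] ⊢ D → (B ⇒ C) ▷[ NNIL ] D
  ▷-NNIL-by-translation B C D ⊢⟦B⟧ ⟦C⟧⊢D E nnilE ⊢E⇒B⇒C = ⇒I (∨-collapse ⟦C⟧∨D ⟦C⟧⊢D′)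
    where
    open Translation B D
    ⟦B⇒C⟧∨D : E ∷ [] ⊢ ⟦ B ⇒ C ⟧ ∨' D
    ⟦B⇒C⟧∨D = ⟦⟧-mp (translate (λ ()) ⊢E⇒B⇒C) (∨I₁ (nnil-to⟦⟧ nnilE hyp₀))
    ⟦C⟧∨D : E ∷ [] ⊢ ⟦ C ⟧ ∨' D
    ⟦C⟧∨D = ⟦⟧-mp ⟦B⇒C⟧∨D (∨I₁ (⊢-mono (λ ()) ⊢⟦B⟧))
    ⟦C⟧⊢D′ : ⟦ C ⟧ ∷ E ∷ [] ⊢ D
    ⟦C⟧⊢D′ = ⊢-mono (∷⁺ʳ _ (λ ())) ⟦C⟧⊢D

lemma4p25 : (nv np n m : ℕ) (E : Fin (n + m) → Form nv np) (F : Fin n → Form nv np)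
    → let B = ⋀ n (λ i → E (i ↑ˡ m) ⇒ F i)
          C = ⋁ m (λ j → E (n ↑ʳ j))
      in (B ⇒ C) ▷[ NNILpar ] ⋁ (n + m) (λ i → B [ E i ])
lemma4p25 nv np n m E F E₀ (nnilE₀ , _) = ▷-NNIL-by-translation B C D ⊢⟦B⟧ ⟦C⟧⊢D E₀ nnilE₀
  where
  premise : Fin n → Form nv np
  premise i = E (i ↑ˡ m) ⇒ F i
  disjunct : Fin m → Form nv np
  disjunct j = E (n ↑ʳ j)
  B C D : Form nv np
  B = ⋀ n premise
  C = ⋁ m disjunct
  D = ⋁ (n + m) (λ i → B [ E i ])
  open Translation B D
  ⟦E⟧⇒D : ∀ {Γ} i → Γ ⊢ ⟦ E i ⟧ → Γ ⊢ D
  ⟦E⟧⇒D i p = ⋁-intro (n + m) (λ i → B [ E i ]) i (⟦⟧-to-bracket (E i) p)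
  ⊢⟦B⟧ : ⊢ ⟦ B ⟧
  ⊢⟦B⟧ = ⟦⟧-⋀-intro n premise λ i →
           ∧I (⇒I (∨I₂ (⟦E⟧⇒D (i ↑ˡ m) hyp₀))) (⇒I (⋀-elim n premise hyp₀ i))
  ⟦C⟧⊢D : ⟦ C ⟧ ∷ [] ⊢ D
  ⟦C⟧⊢D = ⟦⟧-⋁-elim m disjunct (λ j → ⟦E⟧⇒D (n ↑ʳ j)) hyp₀
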